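{- Let $N$ be a natural number and $0<k<N$. For $\delta\subseteq{}^{\underline N}2$, we have $\mathrm{HN}(\delta)>k$ if and only if there is $\delta^*\subseteq{}^{\underline N}2$ such that $\delta\preceq\delta^*$ and the elements of $\delta^*$ have pairwise disjoint domains, each of size $k$. In particular, if there exists a $k$-selector for $\delta\subseteq{}^{\underline N}2$, then $\mathrm{HN}(\delta)\geq k+1$.
   Context: $N$ is identified with $\{0,\ldots,N-1\}$. ${}^{\underline N}2$ is the set of all partial functions $\sigma$ with $\mathrm{dom}(\sigma)\subseteq N$ and values in $\{0,1\}$ (including the empty function). For $\delta_1,\delta_2\subseteq{}^{\underline N}2$, $\delta_1\preceq\delta_2$ iff for every $\sigma\in\delta_1$ there is $\rho\in\delta_2$ with $\rho\subseteq\sigma$. For $\delta\subseteq{}^{\underline N}2$, $\mathrm{hn}(\delta)$ is the maximum of $k+1$ over $k\in\{0,\ldots,N-1\}$ such that for every $\delta'\subseteq\delta$ there is $\delta''\subseteq\delta'$ whose elements have pairwise disjoint domains and $|\bigcup_{\sigma\in\delta''}\mathrm{dom}(\sigma)|\geq k|\delta'|$; and $\mathrm{HN}(\delta)=\max\{\mathrm{hn}(\delta'):\delta'\subseteq{}^{\underline N}2,\ \delta\preceq\delta'\}$. A $k$-selector for $\delta$ is a function $F$ from $\delta$ to the $k$-element subsets of $N$ such that $F(\sigma)\subseteq\mathrm{dom}(\sigma)$ for all $\sigma\in\delta$, and for $\sigma,\rho\in\delta$, $F(\sigma)\cap F(\rho)=\emptyset$ iff $\sigma\neq\rho$. -}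

module Defs where

open import Data.Nat using (ℕ; suc; _*_; _≤_; _<_)
open import Data.Bool using (Bool)
open import Data.Maybe using (Maybe; just; is-just)
open import Data.Fin using (Fin)
open import Data.Vec using (Vec; lookup; map)
open import Data.Fin.Subset using (Subset; _∩_; _⊆_; ∣_∣; ⋃; Empty)
open import Data.List using (List; length)
open import Data.List.Membership.Propositional using (_∈_)
open import Data.List.Relation.Unary.All using (All)
open import Data.List.Relation.Unary.Unique.Propositional using (Unique)
open import Data.List.Relation.Unary.AllPairs using (AllPairs)
open import Data.Product using (Σ; ∃; _×_)
open import Relation.Binary.PropositionalEquality using (_≡_; _≢_)
open import Data.Bool using (if_then_else_)
open import Data.Fin.Subset using (inside; outside)
import Data.List

-- A partial function σ with dom(σ) ⊆ N = {0,…,N-1} and values in {0,1}: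
-- position i is `nothing` when i ∉ dom σ, and `just b` when σ(i) = b.
PF : ℕ → Set
PF N = Vec (Maybe Bool) N

dom : ∀ {N} → PF N → Subset N
dom σ = map (λ x → if is-just x then inside else outside) σ

_⊑_ : ∀ {N} → PF N → PF N → Set
ρ ⊑ σ = ∀ i b → lookup ρ i ≡ just b → lookup σ i ≡ just b

-- A (finite) subset δ ⊆ ᴺ2 is represented by a list of its elements.
Fam : ℕ → Set
Fam N = List (PF N)

-- δ' is a subset of δ, presented as a duplicate-free list
-- (so that length δ' = |δ'|)
SubFam : ∀ {N} → Fam N → Fam N → Set
SubFam δ' δ = Unique δ' × All (_∈ δ) δ'

Disjoint : ∀ {N} → Subset N → Subset N → Set
Disjoint p q = Empty (p ∩ q)

-- the elements of δ have pairwise disjoint domains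
-- (δ duplicate-free, so distinct positions are distinct elements)
PairwiseDisjointDom : ∀ {N} → Fam N → Set
PairwiseDisjointDom δ = AllPairs (λ σ ρ → Disjoint (dom σ) (dom ρ)) δ

_⪯_ : ∀ {N} → Fam N → Fam N → Set
δ₁ ⪯ δ₂ = ∀ σ → σ ∈ δ₁ → ∃ λ ρ → ρ ∈ δ₂ × ρ ⊑ σ

HnCond : ∀ {N} → Fam N → ℕ → Set
HnCond {N} δ k =
  ∀ δ' → SubFam δ' δ →
    ∃ λ δ'' → SubFam δ'' δ' × PairwiseDisjointDom δ''
            × k * length δ' ≤ ∣ ⋃ (Data.List.map dom δ'') ∣

IsMax : (ℕ → Set) → ℕ → Set
IsMax S m = S m × (∀ x → S x → x ≤ m)

IsHn : ∀ {N} → Fam N → ℕ → Set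
IsHn {N} δ = IsMax (λ x → ∃ λ k → k < N × HnCond δ k × x ≡ suc k)

IsHN : ∀ {N} → Fam N → ℕ → Set
IsHN {N} δ = IsMax (λ x → ∃ λ δ' → Unique δ' × δ ⪯ δ' × IsHn δ' x)

-- k-selector for δ (F given on all of ᴺ2; only its values on δ matter)
Selector : ∀ {N} → ℕ → Fam N → (PF N → Subset N) → Set
Selector {N} k δ F =
  (∀ σ → σ ∈ δ → ∣ F σ ∣ ≡ k × F σ ⊆ dom σ) ×
  (∀ σ ρ → σ ∈ δ → ρ ∈ δ →
     (Disjoint (F σ) (F ρ) → σ ≢ ρ) × (σ ≢ ρ → Disjoint (F σ) (F ρ)))

-- HN(δ) > k means that some δ' with δ ⪯ δ' satisfies the hn condition for some j ≥ k: every
-- subfamily I of δ' has domains covering at least k·|I| points.  This is Hall's condition for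
-- choosing k points in the domain of each member of δ', disjointly for distinct members, and
-- restricting each member to its chosen points gives δ*.  Hall's theorem with demands is proved
-- by induction on the total demand: either some tight set splits the problem in two, or a single
-- point can be handed to one index.  Conversely, a family δ* with disjoint k-element domains
-- satisfies the hn condition for k (take δ'' = δ') and for nothing larger (one member covers only
-- k points), so hn(δ*) = k + 1, or N if δ* is empty.  A k-selector F gives such a δ* by
-- restricting each σ to F(σ).

module Submission where

open import Defs
open import Data.Nat using (ℕ; zero; suc; pred; >-nonZero; _+_; _*_; _<_; _≤_; _≤?_; _<?_; z≤n; s≤s; s≤s⁻¹)
open import Data.Nat.Properties
open import Data.Bool using (if_then_else_) renaming (_≟_ to _≟ᵇ_)
open import Data.Fin using (Fin; zero; suc) renaming (_≟_ to _≟ᶠ_)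
open import Data.Fin.Properties using (any?)
open import Data.Fin.Subset
  using (Subset; inside; outside; _∩_; _∪_; ∁; ⁅_⁆; _⊆_; ∣_∣; Nonempty; ⊤; ⋃)
  renaming (_∈_ to _∈ₛ_; _∉_ to _∉ₛ_; ⊥ to ∅)
open import Data.Fin.Subset.Properties
  using (x∈p∩q⁺; x∈p∩q⁻; x∈p∪q⁺; x∈p∪q⁻; drop-∷-⊆; drop-∷-Empty; ∪-identityʳ; ∉⊥; ⊥⊆; ∈⊤; ∣⊥∣≡0;
         x∈⁅x⁆; x∈⁅y⁆⇒x≡y; ∣⁅x⁆∣≡1; p⊆q⇒∣p∣≤∣q∣; x∈p⇒x∉∁p; x∉p⇒x∈∁p; ∩-identityˡ; anySubset?)
  renaming (_∈?_ to _∈?ₛ_)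
open import Data.Vec using ([]; _∷_; lookup; zipWith; here; there)
open import Data.Vec.Functional using (updateAt)
open import Data.Vec.Functional.Properties using (updateAt-updates; updateAt-minimal)
open import Data.Maybe using (just; nothing)
import Data.Maybe.Properties as Maybe
import Data.Vec.Properties as Vec
open import Data.List as List using (List; []; _∷_; map; length; tabulate; deduplicate)
open import Data.List.Membership.Propositional using (_∈_)
open import Data.List.Membership.Propositional.Properties
  using (∈-tabulate⁺; ∈-tabulate⁻; ∈-map⁺; ∈-map⁻; ∈-deduplicate⁺; ∈-deduplicate⁻)
open import Data.List.Relation.Unary.All as All using (All; []; _∷_)
open import Data.List.Relation.Unary.Any as Any using ()
open import Data.List.Relation.Unary.Any.Properties using (lookup-index)
open import Data.List.Relation.Unary.AllPairs using (AllPairs; []; _∷_)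
open import Data.List.Relation.Unary.Unique.Propositional using (Unique)
open import Data.List.Relation.Unary.Unique.DecPropositional.Properties using (deduplicate-!)
open import Data.Product using (∃; _×_; _,_; proj₁; proj₂)
open import Data.Sum using (inj₁; inj₂; [_,_]; [_,_]′)
open import Function using (_∘_; id)
open import Function.Bundles using (_⇔_; mk⇔)
open import Relation.Nullary using (Dec; yes; no; ¬?; contradiction)
open import Relation.Nullary.Decidable using (_×-dec_)
open import Relation.Binary.PropositionalEquality
  using (_≡_; _≢_; refl; sym; trans; cong; cong₂; subst; module ≡-Reasoning)
open import Algebra.Properties.CommutativeSemigroup +-commutativeSemigroup using (interchange; x∙yz≈y∙xz)

private
  variable
    n m : ℕ

disjoint⁺ : {p q : Subset m} → (∀ {x} → x ∈ₛ p → x ∉ₛ q) → Disjoint p q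
disjoint⁺ {p = p} {q = q} p#q (x , x∈p∩q) = let x∈p , x∈q = x∈p∩q⁻ p q x∈p∩q in p#q x∈p x∈q

disjoint⁻ : {p q : Subset m} → Disjoint p q → ∀ {x} → x ∈ₛ p → x ∉ₛ q
disjoint⁻ p#q x∈p x∈q = p#q (_ , x∈p∩q⁺ (x∈p , x∈q))

Disjoint-sym : {p q : Subset m} → Disjoint p q → Disjoint q p
Disjoint-sym p#q = disjoint⁺ λ x∈q x∈p → disjoint⁻ p#q x∈p x∈q

Disjoint-∪ˡ : {p q r : Subset m} → Disjoint p r → Disjoint q r → Disjoint (p ∪ q) r
Disjoint-∪ˡ {p = p} {q = q} p#r q#r = disjoint⁺ λ x∈p∪q → [ disjoint⁻ p#r , disjoint⁻ q#r ] (x∈p∪q⁻ p q x∈p∪q)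

Disjoint-∪ʳ : {p q r : Subset m} → Disjoint p q → Disjoint p r → Disjoint p (q ∪ r)
Disjoint-∪ʳ p#q p#r = Disjoint-sym (Disjoint-∪ˡ (Disjoint-sym p#q) (Disjoint-sym p#r))

Disjoint-∅ : {p : Subset m} → Disjoint ∅ p
Disjoint-∅ = disjoint⁺ λ x∈∅ _ → ∉⊥ x∈∅

⊆-∪-by-cases : {p q r : Subset m} → (∀ {x} → x ∈ₛ p → x ∉ₛ r → x ∈ₛ q) → p ⊆ q ∪ r
⊆-∪-by-cases {q = q} {r} p⊆q∪r {x} x∈p with x ∈?ₛ r
... | yes x∈r = x∈p∪q⁺ {p = q} (inj₂ x∈r)
... | no  x∉r = x∈p∪q⁺ (inj₁ (p⊆q∪r x∈p x∉r))

∣p∪q∣≤∣p∣+∣q∣ : ∀ (p q : Subset m) → ∣ p ∪ q ∣ ≤ ∣ p ∣ + ∣ q ∣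
∣p∪q∣≤∣p∣+∣q∣ []            []            = z≤n
∣p∪q∣≤∣p∣+∣q∣ (inside  ∷ p) (inside  ∷ q) = s≤s (≤-trans (∣p∪q∣≤∣p∣+∣q∣ p q) (+-monoʳ-≤ ∣ p ∣ (n≤1+n ∣ q ∣)))
∣p∪q∣≤∣p∣+∣q∣ (inside  ∷ p) (outside ∷ q) = s≤s (∣p∪q∣≤∣p∣+∣q∣ p q)
∣p∪q∣≤∣p∣+∣q∣ (outside ∷ p) (inside  ∷ q) =
  subst (suc ∣ p ∪ q ∣ ≤_) (sym (+-suc ∣ p ∣ ∣ q ∣)) (s≤s (∣p∪q∣≤∣p∣+∣q∣ p q))
∣p∪q∣≤∣p∣+∣q∣ (outside ∷ p) (outside ∷ q) = ∣p∪q∣≤∣p∣+∣q∣ p q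

∣p∪q∣≡∣p∣+∣q∣ : ∀ (p q : Subset m) → Disjoint p q → ∣ p ∪ q ∣ ≡ ∣ p ∣ + ∣ q ∣
∣p∪q∣≡∣p∣+∣q∣ []            []            _   = refl
∣p∪q∣≡∣p∣+∣q∣ (inside  ∷ p) (inside  ∷ q) p#q = contradiction (zero , here) p#q
∣p∪q∣≡∣p∣+∣q∣ (inside  ∷ p) (outside ∷ q) p#q = cong suc (∣p∪q∣≡∣p∣+∣q∣ p q (drop-∷-Empty p#q))
∣p∪q∣≡∣p∣+∣q∣ (outside ∷ p) (inside  ∷ q) p#q =
  trans (cong suc (∣p∪q∣≡∣p∣+∣q∣ p q (drop-∷-Empty p#q))) (sym (+-suc ∣ p ∣ ∣ q ∣))
∣p∪q∣≡∣p∣+∣q∣ (outside ∷ p) (outside ∷ q) p#q = ∣p∪q∣≡∣p∣+∣q∣ p q (drop-∷-Empty p#q)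

x∈p⇒0<∣p∣ : ∀ {p : Subset m} {x} → x ∈ₛ p → 0 < ∣ p ∣
x∈p⇒0<∣p∣ {p = inside  ∷ p} _           = s≤s z≤n
x∈p⇒0<∣p∣ {p = outside ∷ p} (there x∈p) = x∈p⇒0<∣p∣ x∈p

0<∣p∣⇒Nonempty : ∀ (p : Subset m) → 0 < ∣ p ∣ → Nonempty p
0<∣p∣⇒Nonempty (inside  ∷ p) _   = zero , here
0<∣p∣⇒Nonempty (outside ∷ p) 0<∣p∣ = let x , x∈p = 0<∣p∣⇒Nonempty p 0<∣p∣ in suc x , there x∈p

infix 10 ∑[_]_ ⋃[_]_

∑[_]_ : Subset n → (Fin n → ℕ) → ℕ
∑[ []          ] d = 0
∑[ inside  ∷ K ] d = d zero + ∑[ K ] (d ∘ suc)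
∑[ outside ∷ K ] d = ∑[ K ] (d ∘ suc)

⋃[_]_ : Subset n → (Fin n → Subset m) → Subset m
⋃[ []          ] A = ∅
⋃[ inside  ∷ K ] A = A zero ∪ ⋃[ K ] (A ∘ suc)
⋃[ outside ∷ K ] A = ⋃[ K ] (A ∘ suc)

_↾_ : (Fin n → ℕ) → Subset n → Fin n → ℕ
(d ↾ P) j = if lookup P j then d j else 0

∑-+ : ∀ (K : Subset n) {f g h} → (∀ j → f j + g j ≡ h j) → ∑[ K ] f + ∑[ K ] g ≡ ∑[ K ] h
∑-+ []            f+g≗h = refl
∑-+ (inside  ∷ K) {f} {g} f+g≗h = begin
  (f zero + ∑[ K ] (f ∘ suc)) + (g zero + ∑[ K ] (g ∘ suc))
    ≡⟨ interchange (f zero) _ (g zero) _ ⟩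
  (f zero + g zero) + (∑[ K ] (f ∘ suc) + ∑[ K ] (g ∘ suc))
    ≡⟨ cong₂ _+_ (f+g≗h zero) (∑-+ K (f+g≗h ∘ suc)) ⟩
  _ ∎
  where open ≡-Reasoning
∑-+ (outside ∷ K) f+g≗h = ∑-+ K (f+g≗h ∘ suc)

∑-const : ∀ (K : Subset n) c → ∑[ K ] (λ _ → c) ≡ c * ∣ K ∣
∑-const []            c = sym (*-zeroʳ c)
∑-const (inside  ∷ K) c = trans (cong (c +_) (∑-const K c)) (sym (*-suc c ∣ K ∣))
∑-const (outside ∷ K) c = ∑-const K c

∈⇒≤∑ : ∀ {K : Subset n} {j} d → j ∈ₛ K → d j ≤ ∑[ K ] d
∈⇒≤∑ {K = inside  ∷ K} d here        = m≤m+n _ _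
∈⇒≤∑ {K = inside  ∷ K} d (there j∈K) = ≤-trans (∈⇒≤∑ (d ∘ suc) j∈K) (m≤n+m _ _)
∈⇒≤∑ {K = outside ∷ K} d (there j∈K) = ∈⇒≤∑ (d ∘ suc) j∈K

↾-∈ : ∀ {P : Subset n} {j} d → j ∈ₛ P → (d ↾ P) j ≡ d j
↾-∈ d here        = refl
↾-∈ d (there j∈P) = ↾-∈ (d ∘ suc) j∈P

↾+↾∁ : ∀ (P : Subset n) d j → (d ↾ P) j + (d ↾ ∁ P) j ≡ d j
↾+↾∁ (inside  ∷ P) d zero    = +-identityʳ (d zero)
↾+↾∁ (outside ∷ P) d zero    = refl
↾+↾∁ (_       ∷ P) d (suc j) = ↾+↾∁ P (d ∘ suc) j

∑-↾ : ∀ (K P : Subset n) d → ∑[ K ] (d ↾ P) ≡ ∑[ K ∩ P ] d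
∑-↾ []            []            d = refl
∑-↾ (inside  ∷ K) (inside  ∷ P) d = cong (d zero +_) (∑-↾ K P (d ∘ suc))
∑-↾ (inside  ∷ K) (outside ∷ P) d = ∑-↾ K P (d ∘ suc)
∑-↾ (outside ∷ K) (_       ∷ P) d = ∑-↾ K P (d ∘ suc)

∑-∪ : ∀ (K P : Subset n) d → ∑[ K ∪ P ] d ≡ ∑[ P ] d + ∑[ K ] (d ↾ ∁ P)
∑-∪ []            []            d = refl
∑-∪ (inside  ∷ K) (inside  ∷ P) d =
  trans (cong (d zero +_) (∑-∪ K P (d ∘ suc))) (sym (+-assoc (d zero) _ _))
∑-∪ (inside  ∷ K) (outside ∷ P) d =
  trans (cong (d zero +_) (∑-∪ K P (d ∘ suc))) (x∙yz≈y∙xz (d zero) (∑[ P ] (d ∘ suc)) _)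
∑-∪ (outside ∷ K) (inside  ∷ P) d =
  trans (cong (d zero +_) (∑-∪ K P (d ∘ suc))) (sym (+-assoc (d zero) _ _))
∑-∪ (outside ∷ K) (outside ∷ P) d = ∑-∪ K P (d ∘ suc)

∈⋃⁺ : ∀ {K : Subset n} {A : Fin n → Subset m} {j x} → j ∈ₛ K → x ∈ₛ A j → x ∈ₛ ⋃[ K ] A
∈⋃⁺ {K = inside  ∷ K} {A} here        x∈Aj = x∈p∪q⁺ (inj₁ x∈Aj)
∈⋃⁺ {K = inside  ∷ K} {A} (there j∈K) x∈Aj = x∈p∪q⁺ {p = A zero} (inj₂ (∈⋃⁺ j∈K x∈Aj))
∈⋃⁺ {K = outside ∷ K} (there j∈K) x∈Aj = ∈⋃⁺ j∈K x∈Aj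

∈⋃⁻ : ∀ (K : Subset n) (A : Fin n → Subset m) {x} → x ∈ₛ ⋃[ K ] A → ∃ λ j → j ∈ₛ K × x ∈ₛ A j
∈⋃⁻ []            A x∈⋃ = contradiction x∈⋃ ∉⊥
∈⋃⁻ (inside  ∷ K) A x∈⋃ with x∈p∪q⁻ (A zero) _ x∈⋃
... | inj₁ x∈A0 = zero , here , x∈A0
... | inj₂ x∈⋃' = let j , j∈K , x∈Aj = ∈⋃⁻ K (A ∘ suc) x∈⋃' in suc j , there j∈K , x∈Aj
∈⋃⁻ (outside ∷ K) A x∈⋃ = let j , j∈K , x∈Aj = ∈⋃⁻ K (A ∘ suc) x∈⋃ in suc j , there j∈K , x∈Aj

-- Hall's theorem with demands

record DisjointRepresentatives (A : Fin n → Subset m) (d : Fin n → ℕ) : Set where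
  field
    rep          : Fin n → Subset m
    rep⊆         : ∀ j → rep j ⊆ A j
    ∣rep∣≡d       : ∀ j → ∣ rep j ∣ ≡ d j
    rep-disjoint : ∀ {j l} → j ≢ l → Disjoint (rep j) (rep l)

HallCondition : (Fin n → Subset m) → (Fin n → ℕ) → Set
HallCondition A d = ∀ K → ∑[ K ] d ≤ ∣ ⋃[ K ] A ∣

_⊓_ _∖_ : (Fin n → Subset m) → Subset m → Fin n → Subset m
(A ⊓ V) j = A j ∩ V
(A ∖ V) j = A j ∩ ∁ V

∈⋃∖⁺ : ∀ (K : Subset n) (A : Fin n → Subset m) {V x} → x ∈ₛ ⋃[ K ] A → x ∉ₛ V → x ∈ₛ ⋃[ K ] (A ∖ V)
∈⋃∖⁺ K A x∈⋃ x∉V = let j , j∈K , x∈Aj = ∈⋃⁻ K A x∈⋃ in ∈⋃⁺ j∈K (x∈p∩q⁺ (x∈Aj , x∉p⇒x∈∁p x∉V))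

∣⋃∣≤∣⋃∖∣+∣V∣ : ∀ (K : Subset n) (A : Fin n → Subset m) V → ∣ ⋃[ K ] A ∣ ≤ ∣ ⋃[ K ] (A ∖ V) ∣ + ∣ V ∣
∣⋃∣≤∣⋃∖∣+∣V∣ K A V =
  ≤-trans (p⊆q⇒∣p∣≤∣q∣ (⊆-∪-by-cases {r = V} (∈⋃∖⁺ K A))) (∣p∪q∣≤∣p∣+∣q∣ (⋃[ K ] (A ∖ V)) V)

zeroRepresentatives : ∀ {A : Fin n → Subset m} {d} → (∀ j → d j ≡ 0) → DisjointRepresentatives A d
zeroRepresentatives {m = m} d≡0 = record
  { rep          = λ _ → ∅
  ; rep⊆         = λ _ → ⊥⊆
  ; ∣rep∣≡d       = λ j → trans (∣⊥∣≡0 m) (sym (d≡0 j))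
  ; rep-disjoint = λ _ → Disjoint-∅
  }

glue : ∀ {A : Fin n → Subset m} {d₁ d₂ d} V →
       DisjointRepresentatives (A ⊓ V) d₁ → DisjointRepresentatives (A ∖ V) d₂ →
       (∀ j → d₁ j + d₂ j ≡ d j) → DisjointRepresentatives A d
glue {A = A} V R₁ R₂ d₁+d₂≡d = record
  { rep          = λ j → R₁.rep j ∪ R₂.rep j
  ; rep⊆         = λ j x∈ → [ proj₁ ∘ x∈p∩q⁻ (A j) V ∘ R₁.rep⊆ j , proj₁ ∘ x∈p∩q⁻ (A j) (∁ V) ∘ R₂.rep⊆ j ]′
                              (x∈p∪q⁻ (R₁.rep j) (R₂.rep j) x∈)
  ; ∣rep∣≡d       = λ j → trans (∣p∪q∣≡∣p∣+∣q∣ (R₁.rep j) (R₂.rep j) (across j j))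
                             (trans (cong₂ _+_ (R₁.∣rep∣≡d j) (R₂.∣rep∣≡d j)) (d₁+d₂≡d j))
  ; rep-disjoint = λ {j} {l} j≢l →
      Disjoint-∪ˡ (Disjoint-∪ʳ (R₁.rep-disjoint j≢l) (across j l))
                  (Disjoint-∪ʳ (Disjoint-sym (across l j)) (R₂.rep-disjoint j≢l))
  }
  where
  module R₁ = DisjointRepresentatives R₁
  module R₂ = DisjointRepresentatives R₂
  across : ∀ j l → Disjoint (R₁.rep j) (R₂.rep l)
  across j l = disjoint⁺ λ x∈₁ x∈₂ →
    x∈p⇒x∉∁p (proj₂ (x∈p∩q⁻ (A j) V (R₁.rep⊆ j x∈₁))) (proj₂ (x∈p∩q⁻ (A l) (∁ V) (R₂.rep⊆ l x∈₂)))

unit : Fin n → Fin n → ℕ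
unit i = updateAt (λ _ → 0) i (λ _ → 1)

∑-unit-∈ : ∀ {K : Subset n} {i} → i ∈ₛ K → ∑[ K ] (unit i) ≡ 1
∑-unit-∈ {K = inside  ∷ K} here        = cong suc (∑-const K 0)
∑-unit-∈ {K = inside  ∷ K} (there i∈K) = ∑-unit-∈ i∈K
∑-unit-∈ {K = outside ∷ K} (there i∈K) = ∑-unit-∈ i∈K

∑-unit-∉ : ∀ (K : Subset n) {i} → i ∉ₛ K → ∑[ K ] (unit i) ≡ 0
∑-unit-∉ []            i∉K = refl
∑-unit-∉ (inside  ∷ K) {zero}  i∉K = contradiction here i∉K
∑-unit-∉ (outside ∷ K) {zero}  i∉K = ∑-const K 0
∑-unit-∉ (inside  ∷ K) {suc i} i∉K = ∑-unit-∉ K (i∉K ∘ there)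
∑-unit-∉ (outside ∷ K) {suc i} i∉K = ∑-unit-∉ K (i∉K ∘ there)

unit+pred≡ : ∀ {d : Fin n → ℕ} {i} → 0 < d i → ∀ j → unit i j + updateAt d i pred j ≡ d j
unit+pred≡ {d = d} {i} 0<di j with j ≟ᶠ i
... | yes refl =
  trans (cong₂ _+_ (updateAt-updates j _) (updateAt-updates j d)) (suc-pred (d j) ⦃ >-nonZero 0<di ⦄)
... | no  j≢i  = cong₂ _+_ (updateAt-minimal j i _ j≢i) (updateAt-minimal j i d j≢i)

pointRepresentatives : ∀ {A : Fin n → Subset m} {i x} → x ∈ₛ A i → DisjointRepresentatives (A ⊓ ⁅ x ⁆) (unit i)
pointRepresentatives {m = m} {A = A} {i} {x} x∈Ai = record
  { rep          = rep
  ; rep⊆         = rep⊆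
  ; ∣rep∣≡d       = ∣rep∣≡unit
  ; rep-disjoint = rep-disjoint
  }
  where
  rep : Fin _ → Subset m
  rep = updateAt (λ _ → ∅) i (λ _ → ⁅ x ⁆)
  rep≡∅ : ∀ {j} → j ≢ i → rep j ≡ ∅
  rep≡∅ {j} j≢i = updateAt-minimal j i _ j≢i
  rep⊆ : ∀ j → rep j ⊆ A j ∩ ⁅ x ⁆
  rep⊆ j with j ≟ᶠ i
  ... | yes refl rewrite updateAt-updates j {λ _ → ⁅ x ⁆} (λ _ → ∅) =
    λ y∈⁅x⁆ → x∈p∩q⁺ (subst (_∈ₛ A j) (sym (x∈⁅y⁆⇒x≡y x y∈⁅x⁆)) x∈Ai , y∈⁅x⁆)
  ... | no  j≢i  rewrite rep≡∅ j≢i = ⊥⊆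
  ∣rep∣≡unit : ∀ j → ∣ rep j ∣ ≡ unit i j
  ∣rep∣≡unit j with j ≟ᶠ i
  ... | yes refl = trans (cong ∣_∣ (updateAt-updates j _)) (trans (∣⁅x⁆∣≡1 x) (sym (updateAt-updates j _)))
  ... | no  j≢i  = trans (cong ∣_∣ (rep≡∅ j≢i)) (trans (∣⊥∣≡0 m) (sym (updateAt-minimal j i _ j≢i)))
  rep-disjoint : ∀ {j l} → j ≢ l → Disjoint (rep j) (rep l)
  rep-disjoint {j} {l} j≢l with j ≟ᶠ i
  ... | yes refl rewrite rep≡∅ (j≢l ∘ sym) = Disjoint-sym Disjoint-∅
  ... | no  j≢i  rewrite rep≡∅ j≢i = Disjoint-∅

m+n≤1+o⇒m≤o : ∀ {m n o} → 0 < n → m + n ≤ suc o → m ≤ o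
m+n≤1+o⇒m≤o {m} 0<n m+n≤1+o = s≤s⁻¹ (<-≤-trans (m<m+n m 0<n) m+n≤1+o)

HallUpTo : ℕ → ℕ → ℕ → Set
HallUpTo n m f = ∀ {A : Fin n → Subset m} {d} → ∑[ ⊤ ] d ≤ f → HallCondition A d → DisjointRepresentatives A d

-- Hall's condition survives outside V = ⋃[ I ] A because I, being tight, uses V up exactly.
splitAtTight : ∀ {f} {A : Fin n → Subset m} {d i} (I : Subset n) → HallUpTo n m f →
               HallCondition A d → ∑[ ⊤ ] d ≤ suc f → 0 < d i → i ∉ₛ I →
               0 < ∣ ⋃[ I ] A ∣ → ∣ ⋃[ I ] A ∣ ≤ ∑[ I ] d → DisjointRepresentatives A d
splitAtTight {f = f} {A} {d} {i} I hallUpTo-f hall total 0<di i∉I 0<∣V∣ tight =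
  glue V (hallUpTo-f total₁ hall₁) (hallUpTo-f total₂ hall₂) (↾+↾∁ I d)
  where
  open ≤-Reasoning
  V = ⋃[ I ] A
  d₁ d₂ : Fin _ → ℕ
  d₁ = d ↾ I
  d₂ = d ↾ ∁ I

  total-split : ∑[ ⊤ ] d₁ + ∑[ ⊤ ] d₂ ≡ ∑[ ⊤ ] d
  total-split = ∑-+ ⊤ (↾+↾∁ I d)

  0<∑d₁ : 0 < ∑[ ⊤ ] d₁
  0<∑d₁ = begin-strict
    0            <⟨ 0<∣V∣ ⟩
    ∣ V ∣        ≤⟨ tight ⟩
    ∑[ I ] d     ≡⟨ cong (λ K → ∑[ K ] d) (∩-identityˡ I) ⟨
    ∑[ ⊤ ∩ I ] d ≡⟨ ∑-↾ ⊤ I d ⟨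
    ∑[ ⊤ ] d₁    ∎

  0<∑d₂ : 0 < ∑[ ⊤ ] d₂
  0<∑d₂ = begin-strict
    0          <⟨ 0<di ⟩
    d i        ≡⟨ ↾-∈ d (x∉p⇒x∈∁p i∉I) ⟨
    d₂ i       ≤⟨ ∈⇒≤∑ d₂ ∈⊤ ⟩
    ∑[ ⊤ ] d₂  ∎

  total₁ : ∑[ ⊤ ] d₁ ≤ f
  total₁ = m+n≤1+o⇒m≤o 0<∑d₂ (subst (_≤ suc f) (sym total-split) total)

  total₂ : ∑[ ⊤ ] d₂ ≤ f
  total₂ = m+n≤1+o⇒m≤o 0<∑d₁ (subst (_≤ suc f) (trans (sym total-split) (+-comm (∑[ ⊤ ] d₁) _)) total)

  hall₁ : HallCondition (A ⊓ V) d₁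
  hall₁ K = begin
    ∑[ K ] d₁            ≡⟨ ∑-↾ K I d ⟩
    ∑[ K ∩ I ] d         ≤⟨ hall (K ∩ I) ⟩
    ∣ ⋃[ K ∩ I ] A ∣     ≤⟨ p⊆q⇒∣p∣≤∣q∣ ⋃[K∩I]⊆ ⟩
    ∣ ⋃[ K ] (A ⊓ V) ∣   ∎
    where
    ⋃[K∩I]⊆ : ⋃[ K ∩ I ] A ⊆ ⋃[ K ] (A ⊓ V)
    ⋃[K∩I]⊆ x∈⋃ = let j , j∈K∩I , x∈Aj = ∈⋃⁻ (K ∩ I) A x∈⋃
                      j∈K , j∈I = x∈p∩q⁻ K I j∈K∩I
                  in ∈⋃⁺ j∈K (x∈p∩q⁺ (x∈Aj , ∈⋃⁺ j∈I x∈Aj))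

  hall₂ : HallCondition (A ∖ V) d₂
  hall₂ K = +-cancelˡ-≤ (∑[ I ] d) _ _ (begin
    ∑[ I ] d + ∑[ K ] d₂              ≡⟨ ∑-∪ K I d ⟨
    ∑[ K ∪ I ] d                      ≤⟨ hall (K ∪ I) ⟩
    ∣ ⋃[ K ∪ I ] A ∣                  ≤⟨ p⊆q⇒∣p∣≤∣q∣ (⊆-∪-by-cases {r = V} outside-V) ⟩
    ∣ ⋃[ K ] (A ∖ V) ∪ V ∣            ≤⟨ ∣p∪q∣≤∣p∣+∣q∣ (⋃[ K ] (A ∖ V)) V ⟩
    ∣ ⋃[ K ] (A ∖ V) ∣ + ∣ V ∣        ≤⟨ +-monoʳ-≤ _ tight ⟩
    ∣ ⋃[ K ] (A ∖ V) ∣ + ∑[ I ] d     ≡⟨ +-comm ∣ ⋃[ K ] (A ∖ V) ∣ _ ⟩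
    ∑[ I ] d + ∣ ⋃[ K ] (A ∖ V) ∣     ∎)
    where
    outside-V : ∀ {x} → x ∈ₛ ⋃[ K ∪ I ] A → x ∉ₛ V → x ∈ₛ ⋃[ K ] (A ∖ V)
    outside-V x∈⋃ x∉V with ∈⋃⁻ (K ∪ I) A x∈⋃
    ... | j , j∈K∪I , x∈Aj with x∈p∪q⁻ K I j∈K∪I
    ...   | inj₁ j∈K = ∈⋃⁺ j∈K (x∈p∩q⁺ (x∈Aj , x∉p⇒x∈∁p x∉V))
    ...   | inj₂ j∈I = contradiction (∈⋃⁺ j∈I x∈Aj) x∉V

-- Every set avoiding i whose neighbourhood contains x has slack, so it can afford to lose x.
removePoint : ∀ {f} {A : Fin n → Subset m} {d i x} → HallUpTo n m f →
              HallCondition A d → ∑[ ⊤ ] d ≤ suc f → 0 < d i → x ∈ₛ A i →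
              (∀ K → i ∉ₛ K → x ∈ₛ ⋃[ K ] A → ∑[ K ] d < ∣ ⋃[ K ] A ∣) → DisjointRepresentatives A d
removePoint {f = f} {A} {d} {i} {x} hallUpTo-f hall total 0<di x∈Ai slack =
  glue ⁅ x ⁆ (pointRepresentatives x∈Ai) (hallUpTo-f total' hall') (unit+pred≡ 0<di)
  where
  open ≤-Reasoning
  A' = A ∖ ⁅ x ⁆
  d' = updateAt d i pred

  ∑-split : ∀ K → ∑[ K ] (unit i) + ∑[ K ] d' ≡ ∑[ K ] d
  ∑-split K = ∑-+ K (unit+pred≡ 0<di)

  ∑-∈ : ∀ {K} → i ∈ₛ K → suc (∑[ K ] d') ≡ ∑[ K ] d
  ∑-∈ {K} i∈K = trans (cong (_+ ∑[ K ] d') (sym (∑-unit-∈ i∈K))) (∑-split K)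

  ∑-∉ : ∀ {K} → i ∉ₛ K → ∑[ K ] d' ≡ ∑[ K ] d
  ∑-∉ {K} i∉K = trans (cong (_+ ∑[ K ] d') (sym (∑-unit-∉ K i∉K))) (∑-split K)

  ∣⋃∣≤1+∣⋃'∣ : ∀ K → ∣ ⋃[ K ] A ∣ ≤ suc ∣ ⋃[ K ] A' ∣
  ∣⋃∣≤1+∣⋃'∣ K = begin
    ∣ ⋃[ K ] A ∣                    ≤⟨ ∣⋃∣≤∣⋃∖∣+∣V∣ K A ⁅ x ⁆ ⟩
    ∣ ⋃[ K ] A' ∣ + ∣ ⁅ x ⁆ ∣        ≡⟨ cong (∣ ⋃[ K ] A' ∣ +_) (∣⁅x⁆∣≡1 x) ⟩
    ∣ ⋃[ K ] A' ∣ + 1               ≡⟨ +-comm ∣ ⋃[ K ] A' ∣ 1 ⟩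
    suc ∣ ⋃[ K ] A' ∣               ∎

  ⋃⊆⋃' : ∀ {K} → x ∉ₛ ⋃[ K ] A → ⋃[ K ] A ⊆ ⋃[ K ] A'
  ⋃⊆⋃' {K} x∉⋃ y∈⋃ = ∈⋃∖⁺ K A y∈⋃ λ y∈⁅x⁆ → x∉⋃ (subst (_∈ₛ ⋃[ K ] A) (x∈⁅y⁆⇒x≡y x y∈⁅x⁆) y∈⋃)

  total' : ∑[ ⊤ ] d' ≤ f
  total' = s≤s⁻¹ (subst (_≤ suc f) (sym (∑-∈ ∈⊤)) total)

  hall' : HallCondition A' d'
  hall' K with i ∈?ₛ K
  ... | yes i∈K = s≤s⁻¹ (begin
    suc (∑[ K ] d')     ≡⟨ ∑-∈ i∈K ⟩
    ∑[ K ] d            ≤⟨ hall K ⟩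
    ∣ ⋃[ K ] A ∣        ≤⟨ ∣⋃∣≤1+∣⋃'∣ K ⟩
    suc ∣ ⋃[ K ] A' ∣   ∎)
  ... | no i∉K with x ∈?ₛ ⋃[ K ] A
  ...   | yes x∈⋃ = s≤s⁻¹ (begin-strict
    ∑[ K ] d'           ≡⟨ ∑-∉ i∉K ⟩
    ∑[ K ] d            <⟨ slack K i∉K x∈⋃ ⟩
    ∣ ⋃[ K ] A ∣        ≤⟨ ∣⋃∣≤1+∣⋃'∣ K ⟩
    suc ∣ ⋃[ K ] A' ∣   ∎)
  ...   | no x∉⋃ = begin
    ∑[ K ] d'           ≡⟨ ∑-∉ i∉K ⟩
    ∑[ K ] d            ≤⟨ hall K ⟩
    ∣ ⋃[ K ] A ∣        ≤⟨ p⊆q⇒∣p∣≤∣q∣ (⋃⊆⋃' {K} x∉⋃) ⟩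
    ∣ ⋃[ K ] A' ∣       ∎

HallCondition⇒Nonempty : ∀ {A : Fin n → Subset m} {d i} → HallCondition A d → 0 < d i → Nonempty (A i)
HallCondition⇒Nonempty {A = A} {d} {i} hall 0<di = 0<∣p∣⇒Nonempty (A i) (begin-strict
  0                  <⟨ 0<di ⟩
  d i                ≤⟨ ∈⇒≤∑ d (x∈⁅x⁆ i) ⟩
  ∑[ ⁅ i ⁆ ] d        ≤⟨ hall ⁅ i ⁆ ⟩
  ∣ ⋃[ ⁅ i ⁆ ] A ∣    ≤⟨ p⊆q⇒∣p∣≤∣q∣ ⋃[⁅i⁆]⊆ ⟩
  ∣ A i ∣            ∎)
  where
  open ≤-Reasoning
  ⋃[⁅i⁆]⊆ : ⋃[ ⁅ i ⁆ ] A ⊆ A i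
  ⋃[⁅i⁆]⊆ x∈⋃ = let j , j∈⁅i⁆ , x∈Aj = ∈⋃⁻ ⁅ i ⁆ A x∈⋃ in subst (λ j → _ ∈ₛ A j) (x∈⁅y⁆⇒x≡y i j∈⁅i⁆) x∈Aj

hallStep : ∀ {f} → HallUpTo n m f → HallUpTo n m (suc f)
hallStep hallUpTo-f {A} {d} total hall with any? (λ i → 0 <? d i)
... | no ∄i = zeroRepresentatives (λ i → n≤0⇒n≡0 (≮⇒≥ (∄i ∘ (i ,_))))
... | yes (i , 0<di) with HallCondition⇒Nonempty hall 0<di
...   | x , x∈Ai with anySubset? (λ K → ¬? (i ∈?ₛ K) ×-dec x ∈?ₛ ⋃[ K ] A ×-dec ∣ ⋃[ K ] A ∣ ≤? ∑[ K ] d)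
...     | yes (I , i∉I , x∈V , tight) = splitAtTight I hallUpTo-f hall total 0<di i∉I (x∈p⇒0<∣p∣ x∈V) tight
...     | no ∄I = removePoint hallUpTo-f hall total 0<di x∈Ai
                    (λ K i∉K x∈⋃ → ≰⇒> λ ∣⋃∣≤∑ → ∄I (K , i∉K , x∈⋃ , ∣⋃∣≤∑))

hallUpTo : ∀ f → HallUpTo n m f
hallUpTo zero    {d = d} total _ = zeroRepresentatives (λ i → n≤0⇒n≡0 (≤-trans (∈⇒≤∑ d ∈⊤) total))
hallUpTo (suc f) = hallStep (hallUpTo f)

hall : ∀ {A : Fin n → Subset m} {d} → HallCondition A d → DisjointRepresentatives A d
hall {d = d} = hallUpTo (∑[ ⊤ ] d) ≤-refl

module _ {a} {A : Set a} where

  select : (xs : List A) → Subset (length xs) → List A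
  select []       []            = []
  select (x ∷ xs) (inside  ∷ I) = x ∷ select xs I
  select (x ∷ xs) (outside ∷ I) = select xs I

  length-select : ∀ (xs : List A) I → length (select xs I) ≡ ∣ I ∣
  length-select []       []            = refl
  length-select (x ∷ xs) (inside  ∷ I) = cong suc (length-select xs I)
  length-select (x ∷ xs) (outside ∷ I) = length-select xs I

  ∈-select⁻ : ∀ (xs : List A) I {y} → y ∈ select xs I → y ∈ xs
  ∈-select⁻ []       []            ()
  ∈-select⁻ (x ∷ xs) (inside  ∷ I) (Any.here y≡x)  = Any.here y≡x
  ∈-select⁻ (x ∷ xs) (inside  ∷ I) (Any.there y∈) = Any.there (∈-select⁻ xs I y∈)
  ∈-select⁻ (x ∷ xs) (outside ∷ I) y∈             = Any.there (∈-select⁻ xs I y∈)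

  Unique-select : ∀ {xs : List A} I → Unique xs → Unique (select xs I)
  Unique-select {[]}     []            []              = []
  Unique-select {x ∷ xs} (inside  ∷ I) (x∉xs ∷ unique) =
    All.tabulate (All.lookup x∉xs ∘ ∈-select⁻ xs I) ∷ Unique-select I unique
  Unique-select {x ∷ xs} (outside ∷ I) (_    ∷ unique) = Unique-select I unique

  ⋃-map-select : ∀ (f : A → Subset m) (xs : List A) I → ⋃ (map f (select xs I)) ≡ ⋃[ I ] (f ∘ List.lookup xs)
  ⋃-map-select f []       []            = refl
  ⋃-map-select f (x ∷ xs) (inside  ∷ I) = cong (f x ∪_) (⋃-map-select f xs I)
  ⋃-map-select f (x ∷ xs) (outside ∷ I) = ⋃-map-select f xs I

  ∈⋃-map⁺ : ∀ (f : A → Subset m) {xs y z} → y ∈ xs → z ∈ₛ f y → z ∈ₛ ⋃ (map f xs)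
  ∈⋃-map⁺ f {x ∷ xs} (Any.here refl) z∈fy = x∈p∪q⁺ (inj₁ z∈fy)
  ∈⋃-map⁺ f {x ∷ xs} (Any.there y∈)  z∈fy = x∈p∪q⁺ {p = f x} (inj₂ (∈⋃-map⁺ f y∈ z∈fy))

  ∈⋃-map⁻ : ∀ (f : A → Subset m) xs {z} → z ∈ₛ ⋃ (map f xs) → ∃ λ y → y ∈ xs × z ∈ₛ f y
  ∈⋃-map⁻ f []       z∈⋃ = contradiction z∈⋃ ∉⊥
  ∈⋃-map⁻ f (x ∷ xs) z∈⋃ with x∈p∪q⁻ (f x) _ z∈⋃
  ... | inj₁ z∈fx = x , Any.here refl , z∈fx
  ... | inj₂ z∈⋃' = let y , y∈xs , z∈fy = ∈⋃-map⁻ f xs z∈⋃' in y , Any.there y∈xs , z∈fy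

  ⋃-map-mono : ∀ (f : A → Subset m) {xs ys} → All (_∈ xs) ys → ⋃ (map f ys) ⊆ ⋃ (map f xs)
  ⋃-map-mono f {ys = ys} ys⊆xs z∈⋃ =
    let y , y∈ys , z∈fy = ∈⋃-map⁻ f ys z∈⋃ in ∈⋃-map⁺ f (All.lookup ys⊆xs y∈ys) z∈fy

  Disjoint-⋃-map : ∀ (f : A → Subset m) {p xs} → All (λ y → Disjoint p (f y)) xs → Disjoint p (⋃ (map f xs))
  Disjoint-⋃-map f []            = Disjoint-sym Disjoint-∅
  Disjoint-⋃-map f (p#fx ∷ p#fs) = Disjoint-∪ʳ p#fx (Disjoint-⋃-map f p#fs)

  ∣⋃-map∣ : ∀ (f : A → Subset m) {k xs} → AllPairs (λ x y → Disjoint (f x) (f y)) xs →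
            All (λ x → ∣ f x ∣ ≡ k) xs → ∣ ⋃ (map f xs) ∣ ≡ k * length xs
  ∣⋃-map∣ {m = m} f {k} []                 []               = trans (∣⊥∣≡0 m) (sym (*-zeroʳ k))
  ∣⋃-map∣ f {k} {x ∷ xs} (fx#fs ∷ pairwise) (∣fx∣≡k ∷ sizes) = begin
    ∣ f x ∪ ⋃ (map f xs) ∣            ≡⟨ ∣p∪q∣≡∣p∣+∣q∣ (f x) _ (Disjoint-⋃-map f fx#fs) ⟩
    ∣ f x ∣ + ∣ ⋃ (map f xs) ∣        ≡⟨ cong₂ _+_ ∣fx∣≡k (∣⋃-map∣ f pairwise sizes) ⟩
    k + k * length xs                ≡⟨ *-suc k (length xs) ⟨
    k * suc (length xs)              ∎
    where open ≡-Reasoning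

module _ {a r} {A : Set a} {R : A → A → Set r} where

  ∈-pairwise⇒AllPairs : ∀ {xs} → Unique xs → (∀ {x y} → x ∈ xs → y ∈ xs → x ≢ y → R x y) → AllPairs R xs
  ∈-pairwise⇒AllPairs {[]}     []             _        = []
  ∈-pairwise⇒AllPairs {x ∷ xs} (x∉xs ∷ unique) pairwise =
    All.tabulate (λ y∈xs → pairwise (Any.here refl) (Any.there y∈xs) (All.lookup x∉xs y∈xs)) ∷
    ∈-pairwise⇒AllPairs unique (λ y∈ z∈ → pairwise (Any.there y∈) (Any.there z∈))

  AllPairs⇒∈-pairwise : (∀ {x y} → R x y → R y x) → ∀ {xs} → AllPairs R xs →
                        ∀ {x y} → x ∈ xs → y ∈ xs → x ≢ y → R x y
  AllPairs⇒∈-pairwise sym-R (Rx ∷ _)  (Any.here refl) (Any.here refl) x≢y = contradiction refl x≢y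
  AllPairs⇒∈-pairwise sym-R (Rx ∷ _)  (Any.here refl) (Any.there y∈)  _   = All.lookup Rx y∈
  AllPairs⇒∈-pairwise sym-R (Rx ∷ _)  (Any.there x∈)  (Any.here refl) _   = sym-R (All.lookup Rx x∈)
  AllPairs⇒∈-pairwise sym-R (_ ∷ Rxs) (Any.there x∈)  (Any.there y∈)  x≢y =
    AllPairs⇒∈-pairwise sym-R Rxs x∈ y∈ x≢y

-- Partial functions and their families

private
  variable
    N k : ℕ

restrict : PF N → Subset N → PF N
restrict = zipWith λ v b → if b then v else nothing

dom-restrict : ∀ (σ : PF N) S → S ⊆ dom σ → dom (restrict σ S) ≡ S
dom-restrict []            []            _    = refl
dom-restrict (just v  ∷ σ) (inside  ∷ S) S⊆σ = cong (inside ∷_) (dom-restrict σ S (drop-∷-⊆ S⊆σ))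
dom-restrict (nothing ∷ σ) (inside  ∷ S) S⊆σ = contradiction (S⊆σ here) λ ()
dom-restrict (v       ∷ σ) (outside ∷ S) S⊆σ = cong (outside ∷_) (dom-restrict σ S (drop-∷-⊆ S⊆σ))

restrict-⊑ : ∀ (σ : PF N) S → restrict σ S ⊑ σ
restrict-⊑ (v ∷ σ) (inside  ∷ S) zero    b v≡b = v≡b
restrict-⊑ (v ∷ σ) (outside ∷ S) zero    b ()
restrict-⊑ (v ∷ σ) (_       ∷ S) (suc i) b σᵢ≡b = restrict-⊑ σ S i b σᵢ≡b

⊑-trans : {σ₁ σ₂ σ₃ : PF N} → σ₁ ⊑ σ₂ → σ₂ ⊑ σ₃ → σ₁ ⊑ σ₃
⊑-trans σ₁⊑σ₂ σ₂⊑σ₃ i b σ₁ᵢ≡b = σ₂⊑σ₃ i b (σ₁⊑σ₂ i b σ₁ᵢ≡b)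

_≟ₚ_ : (σ ρ : PF N) → Dec (σ ≡ ρ)
_≟ₚ_ = Vec.≡-dec (Maybe.≡-dec _≟ᵇ_)

DisjointRefinement : ℕ → Fam N → Set
DisjointRefinement k δ = ∃ λ δ* → Unique δ* × δ ⪯ δ* × PairwiseDisjointDom δ* × (∀ σ → σ ∈ δ* → ∣ dom σ ∣ ≡ k)

refinement-deduplicate : ∀ {δ} (L : Fam N) → δ ⪯ L →
                         (∀ {σ ρ} → σ ∈ L → ρ ∈ L → σ ≢ ρ → Disjoint (dom σ) (dom ρ)) →
                         (∀ {σ} → σ ∈ L → ∣ dom σ ∣ ≡ k) → DisjointRefinement k δ
refinement-deduplicate L δ⪯L disjoint sizes =
  deduplicate _≟ₚ_ L ,
  deduplicate-! _≟ₚ_ L ,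
  (λ σ σ∈δ → let ρ , ρ∈L , ρ⊑σ = δ⪯L σ σ∈δ in ρ , ∈-deduplicate⁺ _≟ₚ_ ρ∈L , ρ⊑σ) ,
  ∈-pairwise⇒AllPairs (deduplicate-! _≟ₚ_ L)
    (λ σ∈ ρ∈ → disjoint (∈-deduplicate⁻ _≟ₚ_ L σ∈) (∈-deduplicate⁻ _≟ₚ_ L ρ∈)) ,
  (λ σ σ∈ → sizes (∈-deduplicate⁻ _≟ₚ_ L σ∈))

representatives⇒refinement : ∀ {δ δ' : Fam N} → δ ⪯ δ' →
                             DisjointRepresentatives (dom ∘ List.lookup δ') (λ _ → k) → DisjointRefinement k δ
representatives⇒refinement {δ' = δ'} δ⪯δ' R =
  refinement-deduplicate (tabulate τ) δ⪯τs disjoint sizes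
  where
  open DisjointRepresentatives R
  τ : Fin (length δ') → PF _
  τ i = restrict (List.lookup δ' i) (rep i)
  dom-τ : ∀ i → dom (τ i) ≡ rep i
  dom-τ i = dom-restrict (List.lookup δ' i) (rep i) (rep⊆ i)
  δ⪯τs : _ ⪯ tabulate τ
  δ⪯τs σ σ∈δ with δ⪯δ' σ σ∈δ
  ... | ρ , ρ∈δ' , ρ⊑σ = τ i , ∈-tabulate⁺ i , ⊑-trans {σ₁ = τ i} {ρ} {σ} τᵢ⊑ρ ρ⊑σ
    where
    i = Any.index ρ∈δ'
    τᵢ⊑ρ : τ i ⊑ ρ
    τᵢ⊑ρ = subst (τ i ⊑_) (sym (lookup-index ρ∈δ')) (restrict-⊑ (List.lookup δ' i) (rep i))
  disjoint : ∀ {σ ρ} → σ ∈ tabulate τ → ρ ∈ tabulate τ → σ ≢ ρ → Disjoint (dom σ) (dom ρ)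
  disjoint σ∈ ρ∈ σ≢ρ with ∈-tabulate⁻ σ∈ | ∈-tabulate⁻ ρ∈
  ... | i , refl | j , refl rewrite dom-τ i | dom-τ j = rep-disjoint (σ≢ρ ∘ cong τ)
  sizes : ∀ {σ} → σ ∈ tabulate τ → ∣ dom σ ∣ ≡ _
  sizes σ∈ with ∈-tabulate⁻ σ∈
  ... | i , refl = trans (cong ∣_∣ (dom-τ i)) (∣rep∣≡d i)

selector⇒refinement : ∀ {δ : Fam N} {F} → Selector k δ F → DisjointRefinement k δ
selector⇒refinement {δ = δ} {F} (F-sizes , F-disjoint) =
  refinement-deduplicate (map τ δ) (λ σ σ∈δ → τ σ , ∈-map⁺ τ σ∈δ , restrict-⊑ σ (F σ)) disjoint sizes
  where
  τ : PF _ → PF _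
  τ σ = restrict σ (F σ)
  dom-τ : ∀ {σ} → σ ∈ δ → dom (τ σ) ≡ F σ
  dom-τ {σ} σ∈δ = dom-restrict σ (F σ) (proj₂ (F-sizes σ σ∈δ))
  disjoint : ∀ {σ ρ} → σ ∈ map τ δ → ρ ∈ map τ δ → σ ≢ ρ → Disjoint (dom σ) (dom ρ)
  disjoint σ∈ ρ∈ σ≢ρ with ∈-map⁻ τ σ∈ | ∈-map⁻ τ ρ∈
  ... | σ' , σ'∈δ , refl | ρ' , ρ'∈δ , refl rewrite dom-τ σ'∈δ | dom-τ ρ'∈δ =
    proj₂ (F-disjoint σ' ρ' σ'∈δ ρ'∈δ) (σ≢ρ ∘ cong τ)
  sizes : ∀ {σ} → σ ∈ map τ δ → ∣ dom σ ∣ ≡ _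
  sizes σ∈ with ∈-map⁻ τ σ∈
  ... | σ' , σ'∈δ , refl = trans (cong ∣_∣ (dom-τ σ'∈δ)) (proj₁ (F-sizes σ' σ'∈δ))

-- hn and HN

HnCond⇒HallCondition : ∀ {δ : Fam N} {j} → Unique δ → HnCond δ j → k ≤ j →
                       HallCondition (dom ∘ List.lookup δ) (λ _ → k)
HnCond⇒HallCondition {k = k} {δ} {j} unique hn k≤j I
  with hn (select δ I) (Unique-select I unique , All.tabulate (∈-select⁻ δ I))
... | δ'' , (_ , δ''⊆) , _ , bound = begin
  ∑[ I ] (λ _ → k)                      ≡⟨ ∑-const I k ⟩
  k * ∣ I ∣                              ≤⟨ *-monoˡ-≤ ∣ I ∣ k≤j ⟩
  j * ∣ I ∣                              ≡⟨ cong (j *_) (length-select δ I) ⟨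
  j * length (select δ I)               ≤⟨ bound ⟩
  ∣ ⋃ (map dom δ'') ∣                    ≤⟨ p⊆q⇒∣p∣≤∣q∣ (⋃-map-mono dom δ''⊆) ⟩
  ∣ ⋃ (map dom (select δ I)) ∣           ≡⟨ cong ∣_∣ (⋃-map-select dom δ I) ⟩
  ∣ ⋃[ I ] (dom ∘ List.lookup δ) ∣       ∎
  where open ≤-Reasoning

HnCond-[] : ∀ j → HnCond {N} [] j
HnCond-[] {N} j []      _            = [] , ([] , []) , [] , subst (_≤ ∣ ∅ {N} ∣) (sym (*-zeroʳ j)) z≤n
HnCond-[]     j (_ ∷ _) (_ , () ∷ _)

HnCond-disjoint : ∀ {δ : Fam N} → PairwiseDisjointDom δ → (∀ σ → σ ∈ δ → ∣ dom σ ∣ ≡ k) → HnCond δ k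
HnCond-disjoint {k = k} disjoint sizes δ' (unique , δ'⊆δ) =
  δ' , (unique , All.tabulate id) , disjoint' ,
  ≤-reflexive (sym (∣⋃-map∣ dom disjoint' (All.tabulate (sizes _ ∘ All.lookup δ'⊆δ))))
  where
  disjoint' : PairwiseDisjointDom δ'
  disjoint' = ∈-pairwise⇒AllPairs unique λ σ∈ ρ∈ →
    AllPairs⇒∈-pairwise Disjoint-sym disjoint (All.lookup δ'⊆δ σ∈) (All.lookup δ'⊆δ ρ∈)

HnCond⇒≤∣dom∣ : ∀ {δ : Fam N} {j σ} → HnCond δ j → σ ∈ δ → j ≤ ∣ dom σ ∣
HnCond⇒≤∣dom∣ {j = j} {σ} hn σ∈δ with hn (σ ∷ []) (([] ∷ []) , (σ∈δ ∷ []))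
... | δ'' , (_ , δ''⊆[σ]) , _ , bound = begin
  j                            ≡⟨ *-identityʳ j ⟨
  j * 1                        ≤⟨ bound ⟩
  ∣ ⋃ (map dom δ'') ∣           ≤⟨ p⊆q⇒∣p∣≤∣q∣ (⋃-map-mono dom δ''⊆[σ]) ⟩
  ∣ dom σ ∪ ∅ ∣                 ≡⟨ cong ∣_∣ (∪-identityʳ (dom σ)) ⟩
  ∣ dom σ ∣                     ∎
  where open ≤-Reasoning

HN>k⇒refinement : ∀ {δ : Fam N} {m} → IsHN δ m → k < m → DisjointRefinement k δ
HN>k⇒refinement ((δ' , unique , δ⪯δ' , (j , _ , hn , refl) , _) , _) k<1+j =
  representatives⇒refinement δ⪯δ' (hall (HnCond⇒HallCondition unique hn (s≤s⁻¹ k<1+j)))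

refinement⇒HN>k : ∀ {δ : Fam N} {m} → k < N → DisjointRefinement k δ → IsHN δ m → k < m
refinement⇒HN>k {N = suc N} k<N ([] , _ , δ⪯[] , _) (_ , maximal) =
  ≤-trans k<N (maximal (suc N) ([] , [] , δ⪯[] , hn-[] , λ { _ (j , j<N , _ , refl) → j<N }))
  where
  hn-[] : ∃ λ j → j < suc N × HnCond {suc N} [] j × suc N ≡ suc j
  hn-[] = N , ≤-refl , HnCond-[] N , refl
refinement⇒HN>k {k = k} k<N (δ*@(σ ∷ _) , unique , δ⪯δ* , disjoint , sizes) (_ , maximal) =
  maximal (suc k) (δ* , unique , δ⪯δ* , (k , k<N , HnCond-disjoint disjoint sizes , refl) , hn≤1+k)
  where
  hn≤1+k : ∀ x → (∃ λ j → j < _ × HnCond δ* j × x ≡ suc j) → x ≤ suc k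
  hn≤1+k _ (j , _ , hn , refl) = s≤s (subst (j ≤_) (sizes σ (Any.here refl)) (HnCond⇒≤∣dom∣ hn (Any.here refl)))

-- The argument does not need 0 < k.
mainTheorem13 : (N k : ℕ) → 0 < k → k < N → (δ : Fam N) →
    ((m : ℕ) → IsHN δ m →
      (k < m ⇔ (∃ λ δ* → Unique δ* × δ ⪯ δ* × PairwiseDisjointDom δ*
                         × (∀ σ → σ ∈ δ* → ∣ dom σ ∣ ≡ k))))
    × ((F : PF N → Subset N) → Selector k δ F → (m : ℕ) → IsHN δ m → suc k ≤ m)
mainTheorem13 N k _ k<N δ =
  (λ m HN≡m → mk⇔ (HN>k⇒refinement HN≡m) (λ refinement → refinement⇒HN>k k<N refinement HN≡m)) ,
  (λ F selector m HN≡m → refinement⇒HN>k k<N (selector⇒refinement selector) HN≡m)
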